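{- Let $n \geq 3$ and let $S \subseteq [n]$ be such that $CP_n(S) \neq \emptyset$. Then (1) $cp_{n+1}(S) = 2\, cp_n(S)$; and (2) if $S$ is nonempty and $m = \max S$, then $cp_n(S) = 2^{n-m} cp_m(S)$.
   Context: For integers $a \le b$, $[a,b]=\{a,a+1,\dots,b\}$, $[a,b]=\emptyset$ if $a>b$, and $[n]=[1,n]$. $\mathfrak{S}_n$ is the set of permutations of $[n]$, written in one-line form $\sigma=(\sigma(1)\sigma(2)\cdots\sigma(n))$. The circular peak set of $\sigma\in\mathfrak{S}_n$ is $CP(\sigma)=\{\sigma(i) : 2\le i\le n-1,\ \sigma(i-1)<\sigma(i)>\sigma(i+1)\}$. For $S\subseteq[n]$, $CP_n(S)=\{\sigma\in\mathfrak{S}_n : CP(\sigma)=S\}$ and $cp_n(S)=|CP_n(S)|$. -}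

module Defs where

open import Data.Nat using (ℕ; zero; suc; _<ᵇ_; _≟_)
open import Data.Bool using (Bool; true; false; _∧_; if_then_else_)
open import Data.List using (List; []; _∷_; _++_; map; concatMap; upTo; filter; length)
open import Data.List.Relation.Unary.All using (All; all?)
open import Data.List.Membership.DecPropositional _≟_ using (_∈_; _∈?_)
open import Data.List.Relation.Unary.Unique.Propositional using (Unique)
open import Data.List.Relation.Unary.Unique.DecPropositional _≟_ using (unique?)
open import Data.Product using (_×_)
open import Relation.Nullary using (Dec)
open import Relation.Nullary.Decidable using (_×-dec_)

interval1 : ℕ → List ℕ
interval1 m = map suc (upTo m)

words : ℕ → ℕ → List (List ℕ)
words zero    m = [] ∷ []
words (suc k) m = concatMap (λ a → map (a ∷_) (words k m)) (interval1 m)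

-- the permutations of [n] in one-line form are exactly the words of length n
-- over [n] with pairwise distinct letters
IsPerm : List ℕ → Set
IsPerm w = Unique w

peaks : List ℕ → List ℕ
peaks (a ∷ b ∷ c ∷ rest) =
  (if (a <ᵇ b) ∧ (c <ᵇ b) then b ∷ [] else []) ++ peaks (b ∷ c ∷ rest)
peaks _ = []

SameSet : List ℕ → List ℕ → Set
SameSet xs ys = All (_∈ ys) xs × All (_∈ xs) ys

sameSet? : (xs ys : List ℕ) → Dec (SameSet xs ys)
sameSet? xs ys = all? (_∈? ys) xs ×-dec all? (_∈? xs) ys

-- σ ∈ CP_n(S)  (for a word σ of length n over [n])
InCP : List ℕ → List ℕ → Set
InCP S w = IsPerm w × SameSet (peaks w) S

cp : ℕ → List ℕ → ℕ
cp n S = length (filter (λ w → unique? w ×-dec sameSet? (peaks w) S) (words n n))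

module Submission where

-- The letter n+1 of a permutation of [n+1] is a peak unless it stands at one
-- end, and n+1 ∉ S; so every σ ∈ CP_{n+1}(S) is n+1 prepended or appended to
-- some τ of [n]. Prepending or appending a letter larger than all others
-- creates and destroys no peak, hence σ ↦ τ is a two-to-one map onto CP_n(S)
-- (n ≥ 1 keeps the two ends apart). Part (2) iterates (1) from m = max S to n.

open import Defs
open import Data.Bool using (true; false; _∧_; if_then_else_)
open import Data.Bool.Properties using (∧-zeroʳ)
open import Data.Nat using (ℕ; zero; suc; _≤_; _<_; _+_; _*_; _^_; _∸_; z≤n; s≤s; s≤s⁻¹; _<ᵇ_; _≟_)
open import Data.Nat.Properties
  using (≤-trans; ≤-refl; ≤∧≢⇒<; m≤n⇒m≤1+n; m≤n+m; 1+n≰n; suc-injective;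
         +-comm; +-identityʳ; *-assoc; m∸n+n≡m; module ≤-Reasoning)
open import Data.List
  using (List; []; _∷_; _++_; _∷ʳ_; map; concatMap; upTo; filter; length; cartesianProductWith)
open import Data.List.Properties
  using (length-map; length-upTo; length-++; length-filter;
         ∷-injective; ∷-injectiveˡ; ∷-injectiveʳ; ∷ʳ-injective)
open import Data.List.Membership.Propositional using (_∈_; _∉_)
open import Data.List.Membership.Propositional.Properties
  using (∈-map⁺; ∈-map⁻; ∈-upTo⁺; ∈-upTo⁻; ∈-filter⁺; ∈-filter⁻; ∈-++⁺ˡ; ∈-++⁺ʳ; ∈-++⁻; ∈-∃++; ∈-insert;
         ∈-cartesianProductWith⁺; ∈-cartesianProductWith⁻)
open import Data.List.Membership.Propositional.Properties.WithK using (unique∧set⇒bag)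
open import Data.List.Membership.DecPropositional _≟_ using (_∈?_)
open import Data.List.Relation.Binary.Subset.Propositional using (_⊆_)
open import Data.List.Relation.Binary.Disjoint.Propositional using (Disjoint)
open import Data.List.Relation.Binary.BagAndSetEquality using (_∼[_]_; set; ∼bag⇒↭)
open import Data.List.Relation.Binary.Permutation.Propositional.Properties using (↭-length)
open import Data.List.Relation.Unary.Any using (here; there)
open import Data.List.Relation.Unary.All using (All; []; _∷_; lookup; tabulate) renaming (map to All-map)
import Data.List.Relation.Unary.All.Properties as All
open import Data.List.Relation.Unary.AllPairs using ([]; _∷_)
open import Data.List.Relation.Unary.Unique.Propositional using (Unique)
open import Data.List.Relation.Unary.Unique.DecPropositional _≟_ using (unique?)
import Data.List.Relation.Unary.Unique.Propositional.Properties as Unique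
open import Data.Product using (_×_; _,_; proj₁; proj₂)
open import Data.Sum using (inj₁; inj₂)
open import Data.Empty using (⊥-elim)
open import Function using (_∘_; _⇔_; mk⇔; Equivalence)
open import Relation.Nullary using (Dec; yes; no)
open import Relation.Nullary.Decidable using (_×-dec_)
open import Relation.Binary.PropositionalEquality
  using (_≡_; _≢_; refl; sym; trans; cong; cong₂; subst; module ≡-Reasoning)

open Equivalence using (to; from)

unique-∼set⇒length-≡ : {A : Set} {xs ys : List A} →
  Unique xs → Unique ys → xs ∼[ set ] ys → length xs ≡ length ys
unique-∼set⇒length-≡ uxs uys xs∼ys = ↭-length (∼bag⇒↭ (unique∧set⇒bag uxs uys xs∼ys))

unique-⊆⇒length-≤ : {xs ys : List ℕ} → Unique xs → Unique ys → xs ⊆ ys → length xs ≤ length ys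
unique-⊆⇒length-≤ {xs} {ys} uxs uys xs⊆ys = begin
  length xs                   ≡⟨ unique-∼set⇒length-≡ uxs (Unique.filter⁺ (_∈? xs) uys) xs∼ys∩xs ⟩
  length (filter (_∈? xs) ys) ≤⟨ length-filter (_∈? xs) ys ⟩
  length ys                   ∎
  where
  open ≤-Reasoning
  xs∼ys∩xs : xs ∼[ set ] filter (_∈? xs) ys
  xs∼ys∩xs = mk⇔ (λ x∈xs → ∈-filter⁺ (_∈? xs) (xs⊆ys x∈xs) x∈xs) (proj₂ ∘ ∈-filter⁻ (_∈? xs) {xs = ys})

Unique-++⁻ˡ : ∀ (xs : List ℕ) {ys} → Unique (xs ++ ys) → Unique xs
Unique-++⁻ˡ []       _            = []
Unique-++⁻ˡ (x ∷ xs) (x∉xs ∷ uxs) = All.++⁻ˡ xs x∉xs ∷ Unique-++⁻ˡ xs uxs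

Unique-++-∷⁻ : ∀ (xs : List ℕ) {y ys} → Unique (xs ++ y ∷ ys) → y ∉ xs × y ∉ ys
Unique-++-∷⁻ []       (y∉ys ∷ _)  = (λ ()) , λ y∈ys → lookup y∉ys y∈ys refl
Unique-++-∷⁻ (x ∷ xs) (x∉ ∷ uxs) with y∉xs , y∉ys ← Unique-++-∷⁻ xs uxs =
  (λ { (here refl) → lookup x∉ (∈-insert xs) refl ; (there y∈xs) → y∉xs y∈xs }) , y∉ys

Unique-∷⇔ : ∀ {x : ℕ} {xs} → x ∉ xs → Unique (x ∷ xs) ⇔ Unique xs
Unique-∷⇔ x∉xs = mk⇔ (λ { (_ ∷ uxs) → uxs }) (All.¬Any⇒All¬ _ x∉xs ∷_)

Unique-∷ʳ⇔ : ∀ {x : ℕ} {xs} → x ∉ xs → Unique (xs ∷ʳ x) ⇔ Unique xs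
Unique-∷ʳ⇔ {x} {xs} x∉xs = mk⇔ (Unique-++⁻ˡ xs)
  (λ uxs → Unique.++⁺ uxs ([] ∷ []) λ { (x∈xs , here refl) → x∉xs x∈xs })

Letter : ℕ → ℕ → Set
Letter m x = 1 ≤ x × x ≤ m

Letters⇒< : ∀ {m w} → All (Letter m) w → All (_< suc m) w
Letters⇒< = All-map (s≤s ∘ proj₂)

Letter-weaken : ∀ {m x} → Letter m x → Letter (suc m) x
Letter-weaken (1≤x , x≤m) = 1≤x , m≤n⇒m≤1+n x≤m

Letter-strengthen : ∀ {m x} → Letter (suc m) x → x ≢ suc m → Letter m x
Letter-strengthen (1≤x , x≤1+m) x≢1+m = 1≤x , s≤s⁻¹ (≤∧≢⇒< x≤1+m x≢1+m)

suc∉Letters : ∀ {m w} → All (Letter m) w → suc m ∉ w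
suc∉Letters letters 1+m∈w = 1+n≰n (proj₂ (lookup letters 1+m∈w))

Letters-strengthen : ∀ {m w} → All (Letter (suc m)) w → suc m ∉ w → All (Letter m) w
Letters-strengthen letters 1+m∉w =
  tabulate λ x∈w → Letter-strengthen (lookup letters x∈w) λ { refl → 1+m∉w x∈w }

∈-interval1⁻ : ∀ {m x} → x ∈ interval1 m → Letter m x
∈-interval1⁻ x∈ with _ , i∈ , refl ← ∈-map⁻ suc x∈ = s≤s z≤n , ∈-upTo⁻ i∈

∈-interval1⁺ : ∀ {m x} → Letter m x → x ∈ interval1 m
∈-interval1⁺ {x = suc x} (_ , x<m) = ∈-map⁺ suc (∈-upTo⁺ x<m)

interval1-unique : ∀ m → Unique (interval1 m)
interval1-unique m = Unique.map⁺ suc-injective (Unique.upTo⁺ m)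

length-interval1 : ∀ m → length (interval1 m) ≡ m
length-interval1 m = trans (length-map suc (upTo m)) (length-upTo m)

unique-Letters⇒length-≤ : ∀ {m w} → Unique w → All (Letter m) w → length w ≤ m
unique-Letters⇒length-≤ {m} {w} uw letters = subst (length w ≤_) (length-interval1 m)
  (unique-⊆⇒length-≤ uw (interval1-unique m) (∈-interval1⁺ ∘ lookup letters))

max∈full : ∀ {m w} → Unique w → All (Letter (suc m)) w → length w ≡ suc m → suc m ∈ w
max∈full {m} {w} uw letters len with suc m ∈? w
... | yes 1+m∈w = 1+m∈w
... | no  1+m∉w = ⊥-elim (1+n≰n (subst (_≤ m) len
        (unique-Letters⇒length-≤ uw (Letters-strengthen letters 1+m∉w))))

length-∷ʳ : ∀ (v : List ℕ) x → length (v ∷ʳ x) ≡ suc (length v)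
length-∷ʳ v x = trans (length-++ v) (+-comm (length v) 1)

concatMap-map≡cartesianProductWith : {A B C : Set} (f : A → B → C) (xs : List A) (ys : List B) →
  concatMap (λ x → map (f x) ys) xs ≡ cartesianProductWith f xs ys
concatMap-map≡cartesianProductWith f []       ys = refl
concatMap-map≡cartesianProductWith f (x ∷ xs) ys =
  cong (map (f x) ys ++_) (concatMap-map≡cartesianProductWith f xs ys)

words-suc : ∀ k m → words (suc k) m ≡ cartesianProductWith _∷_ (interval1 m) (words k m)
words-suc k m = concatMap-map≡cartesianProductWith _∷_ (interval1 m) (words k m)

∈-words⁻ : ∀ k m {w} → w ∈ words k m → length w ≡ k × All (Letter m) w
∈-words⁻ zero    m (here refl) = refl , []
∈-words⁻ (suc k) m w∈
  with _ , v , a∈ , v∈ , refl ← ∈-cartesianProductWith⁻ _∷_ (interval1 m) (words k m)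
                                   (subst (_ ∈_) (words-suc k m) w∈)
  with len , letters ← ∈-words⁻ k m v∈
  = cong suc len , ∈-interval1⁻ a∈ ∷ letters

∈-words⁺ : ∀ k m {w} → length w ≡ k → All (Letter m) w → w ∈ words k m
∈-words⁺ zero    m {[]}    refl []                 = here refl
∈-words⁺ (suc k) m {a ∷ w} len  (a-letter ∷ letters) = subst (_ ∈_) (sym (words-suc k m))
  (∈-cartesianProductWith⁺ _∷_ (∈-interval1⁺ a-letter) (∈-words⁺ k m (suc-injective len) letters))

words-unique : ∀ k m → Unique (words k m)
words-unique zero    m = [] ∷ []
words-unique (suc k) m = subst Unique (sym (words-suc k m))
  (Unique.cartesianProductWith⁺ _∷_ ∷-injective (interval1-unique m) (words-unique k m))

<⇒<ᵇ≡true : ∀ {a b} → a < b → (a <ᵇ b) ≡ true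
<⇒<ᵇ≡true {zero}  {suc b} _         = refl
<⇒<ᵇ≡true {suc a} {suc b} (s≤s a<b) = <⇒<ᵇ≡true a<b

>⇒<ᵇ≡false : ∀ {a b} → b < a → (a <ᵇ b) ≡ false
>⇒<ᵇ≡false {suc a} {zero}  _         = refl
>⇒<ᵇ≡false {suc a} {suc b} (s≤s b<a) = >⇒<ᵇ≡false b<a

peaks-∷-max : ∀ N v → All (_< N) v → peaks (N ∷ v) ≡ peaks v
peaks-∷-max N []          _           = refl
peaks-∷-max N (b ∷ [])    _           = refl
peaks-∷-max N (b ∷ c ∷ r) (b<N ∷ _) rewrite >⇒<ᵇ≡false b<N = refl

peaks-∷ʳ-max : ∀ N v → All (_< N) v → peaks (v ∷ʳ N) ≡ peaks v
peaks-∷ʳ-max N []              _                 = refl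
peaks-∷ʳ-max N (a ∷ [])        _                 = refl
peaks-∷ʳ-max N (a ∷ b ∷ [])    (_ ∷ b<N ∷ [])
  rewrite >⇒<ᵇ≡false b<N | ∧-zeroʳ (a <ᵇ b) = refl
peaks-∷ʳ-max N (a ∷ b ∷ c ∷ r) (_ ∷ bcr<N) =
  cong ((if (a <ᵇ b) ∧ (c <ᵇ b) then b ∷ [] else []) ++_) (peaks-∷ʳ-max N (b ∷ c ∷ r) bcr<N)

peaks-∷⁺ : ∀ a u {y} → y ∈ peaks u → y ∈ peaks (a ∷ u)
peaks-∷⁺ a (b ∷ c ∷ r) y∈ = ∈-++⁺ʳ _ y∈

max∈peaks : ∀ N a xs c r → All (_< N) (a ∷ xs) → c < N → N ∈ peaks (a ∷ xs ++ N ∷ c ∷ r)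
max∈peaks N a []       c r (a<N ∷ _) c<N rewrite <⇒<ᵇ≡true a<N | <⇒<ᵇ≡true c<N = here refl
max∈peaks N a (b ∷ xs) c r (_ ∷ bxs<N) c<N =
  peaks-∷⁺ a (b ∷ xs ++ N ∷ c ∷ r) (max∈peaks N b xs c r bxs<N c<N)

inCP? : ∀ S w → Dec (InCP S w)
inCP? S w = unique? w ×-dec sameSet? (peaks w) S

CP : ℕ → List ℕ → List (List ℕ)
CP n S = filter (inCP? S) (words n n)

CP-unique : ∀ n S → Unique (CP n S)
CP-unique n S = Unique.filter⁺ (inCP? S) (words-unique n n)

∈-CP⁻ : ∀ {n S w} → w ∈ CP n S → length w ≡ n × All (Letter n) w × InCP S w
∈-CP⁻ {n} {S} w∈ with w∈words , inCP ← ∈-filter⁻ (inCP? S) {xs = words n n} w∈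
  with len , letters ← ∈-words⁻ n n w∈words
  = len , letters , inCP

∈-CP⁺ : ∀ {n S w} → length w ≡ n → All (Letter n) w → InCP S w → w ∈ CP n S
∈-CP⁺ {n} {S} len letters inCP = ∈-filter⁺ (inCP? S) (∈-words⁺ n n len letters) inCP

InCP-resp : ∀ {S w w′} → Unique w ⇔ Unique w′ → peaks w ≡ peaks w′ → InCP S w ⇔ InCP S w′
InCP-resp {S} w⇔w′ peaks≡ = mk⇔
  (λ (uw , peaks≈S) → to w⇔w′ uw , subst (λ p → SameSet p S) peaks≡ peaks≈S)
  (λ (uw′ , peaks≈S) → from w⇔w′ uw′ , subst (λ p → SameSet p S) (sym peaks≡) peaks≈S)

module _ (n : ℕ) where

  private
    N : ℕ
    N = suc n

    Letter-N : Letter N N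
    Letter-N = s≤s z≤n , ≤-refl

  ∷-max-∈CP⇔ : ∀ {S v} → N ∷ v ∈ CP N S ⇔ v ∈ CP n S
  ∷-max-∈CP⇔ {S} {v} = mk⇔ deleteN insertN
    where
    InCP⇔ : All (Letter n) v → InCP S (N ∷ v) ⇔ InCP S v
    InCP⇔ letters = InCP-resp (Unique-∷⇔ (suc∉Letters letters)) (peaks-∷-max N v (Letters⇒< letters))

    deleteN : N ∷ v ∈ CP N S → v ∈ CP n S
    deleteN Nv∈ with len , _ ∷ Nletters , inCP ← ∈-CP⁻ Nv∈ =
      let letters = Letters-strengthen Nletters (Unique.Unique[x∷xs]⇒x∉xs (proj₁ inCP))
      in ∈-CP⁺ (suc-injective len) letters (to (InCP⇔ letters) inCP)

    insertN : v ∈ CP n S → N ∷ v ∈ CP N S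
    insertN v∈ with len , letters , inCP ← ∈-CP⁻ v∈ =
      ∈-CP⁺ (cong suc len) (Letter-N ∷ All-map Letter-weaken letters) (from (InCP⇔ letters) inCP)

  ∷ʳ-max-∈CP⇔ : ∀ {S v} → v ∷ʳ N ∈ CP N S ⇔ v ∈ CP n S
  ∷ʳ-max-∈CP⇔ {S} {v} = mk⇔ deleteN insertN
    where
    InCP⇔ : All (Letter n) v → InCP S (v ∷ʳ N) ⇔ InCP S v
    InCP⇔ letters = InCP-resp (Unique-∷ʳ⇔ (suc∉Letters letters)) (peaks-∷ʳ-max N v (Letters⇒< letters))

    deleteN : v ∷ʳ N ∈ CP N S → v ∈ CP n S
    deleteN vN∈ with len , vNletters , inCP ← ∈-CP⁻ vN∈ =
      let letters = Letters-strengthen (proj₁ (All.∷ʳ⁻ vNletters)) (proj₁ (Unique-++-∷⁻ v (proj₁ inCP)))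
      in ∈-CP⁺ (suc-injective (trans (sym (length-∷ʳ v N)) len)) letters (to (InCP⇔ letters) inCP)

    insertN : v ∈ CP n S → v ∷ʳ N ∈ CP N S
    insertN v∈ with len , letters , inCP ← ∈-CP⁻ v∈ =
      ∈-CP⁺ (trans (length-∷ʳ v N) (cong suc len)) (All.∷ʳ⁺ (All-map Letter-weaken letters) Letter-N)
            (from (InCP⇔ letters) inCP)

  interior-max∉CP : ∀ {S} → N ∉ S → ∀ a xs c r → a ∷ xs ++ N ∷ c ∷ r ∉ CP N S
  interior-max∉CP N∉S a xs c r w∈
    with _ , letters , uw , peaks⊆S , _ ← ∈-CP⁻ w∈
    with N∉axs , N∉cr ← Unique-++-∷⁻ (a ∷ xs) uw
    with _ ∷ c-letter ∷ _ ← All.++⁻ʳ (a ∷ xs) letters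
    = N∉S (lookup peaks⊆S (max∈peaks N a xs c r axs<N c<N))
    where
    axs<N : All (_< N) (a ∷ xs)
    axs<N = Letters⇒< (Letters-strengthen (All.++⁻ˡ (a ∷ xs) letters) N∉axs)
    c<N : c < N
    c<N = ≤∧≢⇒< (proj₂ c-letter) λ { refl → N∉cr (here refl) }

  Ends : List ℕ → List (List ℕ)
  Ends S = map (N ∷_) (CP n S) ++ map (_∷ʳ N) (CP n S)

  ∈Ends⇒∈CP : ∀ {S w} → w ∈ Ends S → w ∈ CP N S
  ∈Ends⇒∈CP {S} w∈ with ∈-++⁻ (map (N ∷_) (CP n S)) w∈
  ... | inj₁ w∈₁ with _ , v∈ , refl ← ∈-map⁻ (N ∷_) w∈₁  = from ∷-max-∈CP⇔ v∈
  ... | inj₂ w∈₂ with _ , v∈ , refl ← ∈-map⁻ (_∷ʳ N) w∈₂ = from ∷ʳ-max-∈CP⇔ v∈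

  ∈CP⇒∈Ends : ∀ {S} → N ∉ S → ∀ {w} → w ∈ CP N S → w ∈ Ends S
  ∈CP⇒∈Ends {S} N∉S w∈ with len , letters , uw , _ ← ∈-CP⁻ w∈
    with xs , ys , refl ← ∈-∃++ (max∈full {n} uw letters len) = split xs ys w∈
    where
    split : ∀ xs ys → xs ++ N ∷ ys ∈ CP N S → xs ++ N ∷ ys ∈ Ends S
    split []       ys      w∈ = ∈-++⁺ˡ (∈-map⁺ (N ∷_) (to ∷-max-∈CP⇔ w∈))
    split (a ∷ xs) []      w∈ = ∈-++⁺ʳ _ (∈-map⁺ (_∷ʳ N) (to (∷ʳ-max-∈CP⇔ {v = a ∷ xs}) w∈))
    split (a ∷ xs) (c ∷ r) w∈ = ⊥-elim (interior-max∉CP N∉S a xs c r w∈)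

  Ends-unique : ∀ {S} → 1 ≤ n → Unique (Ends S)
  Ends-unique {S} 1≤n = Unique.++⁺ (Unique.map⁺ ∷-injectiveʳ (CP-unique n S))
    (Unique.map⁺ (proj₁ ∘ ∷ʳ-injective _ _) (CP-unique n S)) disjoint
    where
    ends-differ : ∀ {x v} → v ∈ CP n S → N ∷ x ≢ v ∷ʳ N
    ends-differ {v = []}    v∈ _  = 1+n≰n (subst (1 ≤_) (sym (proj₁ (∈-CP⁻ v∈))) 1≤n)
    ends-differ {v = _ ∷ _} v∈ eq = suc∉Letters (proj₁ (proj₂ (∈-CP⁻ v∈))) (here (∷-injectiveˡ eq))

    disjoint : Disjoint (map (N ∷_) (CP n S)) (map (_∷ʳ N) (CP n S))
    disjoint (p , q) with _ , _ , refl ← ∈-map⁻ (N ∷_) p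
      with _ , v∈ , eq ← ∈-map⁻ (_∷ʳ N) q = ends-differ v∈ eq

  cp-suc : ∀ {S} → 1 ≤ n → N ∉ S → cp N S ≡ 2 * cp n S
  cp-suc {S} 1≤n N∉S = begin
    length (CP N S)
      ≡⟨ unique-∼set⇒length-≡ (CP-unique N S) (Ends-unique 1≤n) (mk⇔ (∈CP⇒∈Ends N∉S) ∈Ends⇒∈CP) ⟩
    length (Ends S)
      ≡⟨ length-++ (map (N ∷_) (CP n S)) ⟩
    length (map (N ∷_) (CP n S)) + length (map (_∷ʳ N) (CP n S))
      ≡⟨ cong₂ _+_ (length-map (N ∷_) (CP n S)) (length-map (_∷ʳ N) (CP n S)) ⟩
    cp n S + cp n S
      ≡⟨ cong (cp n S +_) (sym (+-identityʳ (cp n S))) ⟩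
    2 * cp n S
      ∎
    where open ≡-Reasoning

cp-+-max : ∀ m S → 1 ≤ m → (∀ x → x ∈ S → x ≤ m) → ∀ d → cp (d + m) S ≡ 2 ^ d * cp m S
cp-+-max m S 1≤m S≤m zero    = sym (+-identityʳ (cp m S))
cp-+-max m S 1≤m S≤m (suc d) = begin
  cp (suc (d + m)) S     ≡⟨ cp-suc (d + m) (≤-trans 1≤m (m≤n+m m d)) d+m+1∉S ⟩
  2 * cp (d + m) S       ≡⟨ cong (2 *_) (cp-+-max m S 1≤m S≤m d) ⟩
  2 * (2 ^ d * cp m S)   ≡⟨ sym (*-assoc 2 (2 ^ d) (cp m S)) ⟩
  2 ^ suc d * cp m S     ∎
  where
  open ≡-Reasoning
  d+m+1∉S : suc (d + m) ∉ S
  d+m+1∉S d+m+1∈S = 1+n≰n (≤-trans (S≤m _ d+m+1∈S) (m≤n+m m d))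

lemma2p1 : (n : ℕ) (S : List ℕ) → 3 ≤ n →
    (∀ x → x ∈ S → 1 ≤ x × x ≤ n) →
    cp n S ≢ 0 →
    (cp (suc n) S ≡ 2 * cp n S)
    × (∀ m → m ∈ S → (∀ x → x ∈ S → x ≤ m) → cp n S ≡ 2 ^ (n ∸ m) * cp m S)
lemma2p1 n S 3≤n S⊆[n] _ = cp-suc n (≤-trans (s≤s z≤n) 3≤n) n+1∉S , cp-max
  where
  open ≡-Reasoning
  n+1∉S : suc n ∉ S
  n+1∉S n+1∈S = 1+n≰n (proj₂ (S⊆[n] _ n+1∈S))

  cp-max : ∀ m → m ∈ S → (∀ x → x ∈ S → x ≤ m) → cp n S ≡ 2 ^ (n ∸ m) * cp m S
  cp-max m m∈S S≤m = begin
    cp n S               ≡⟨ cong (λ k → cp k S) (sym (m∸n+n≡m (proj₂ (S⊆[n] m m∈S)))) ⟩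
    cp (n ∸ m + m) S     ≡⟨ cp-+-max m S (proj₁ (S⊆[n] m m∈S)) S≤m (n ∸ m) ⟩
    2 ^ (n ∸ m) * cp m S ∎
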